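{- Let $n$ be a positive integer with Zeckendorf representation $n=f_{\mu_1(n)}+\dots+f_{\mu_q(n)}$, let $k\ge 0$ and $h\ge 0$ be integers, and assume $\mu_1(n)>k$. Let $F_{k,h}(n)$ be the number of Fibonacci partitions $\{f_{a_1},\dots,f_{a_h}\}$ ($1\le a_1<\dots<a_h$) of $n$ with $h$ parts and $a_1>k$. Then \[F_{k,h}(n)=F_h\big(f_{\mu_1(n)-k}+\dots+f_{\mu_q(n)-k}\big).\]
   Context: Let $f_0=f_1=1$ and $f_i=f_{i-1}+f_{i-2}$ for $i\ge 2$. A Fibonacci partition of $n\in\mathbb{N}$ is a finite set $\{f_{i_1},\dots,f_{i_h}\}$ with $1\le i_1<\dots<i_h$ and $f_{i_1}+\dots+f_{i_h}=n$; $F_h(n)$ is the number of Fibonacci partitions of $n$ with exactly $h$ parts. By Zeckendorf's theorem each $n$ has a unique Fibonacci partition $n=f_{\mu_1(n)}+\dots+f_{\mu_q(n)}$ with $\mu_{a+1}(n)-\mu_a(n)\ge 2$. -}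

module Defs where

open import Data.Nat using (ℕ; zero; suc; _+_; _≤_; _<_; _≟_)
open import Data.List using (List; []; _∷_; map; length; filter; _++_)
open import Data.Nat.ListAction using (sum)
open import Data.List.Relation.Unary.All using (All)
open import Data.List.Relation.Unary.Linked using (Linked)
open import Data.Product using (_×_)
open import Relation.Binary.PropositionalEquality using (_≡_)
open import Relation.Nullary.Decidable using (_×-dec_)

f : ℕ → ℕ
f zero = 1
f (suc zero) = 1
f (suc (suc i)) = f (suc i) + f i

-- All sublists (subsequences) of a list; applied to a strictly increasing
-- list of indices this enumerates all finite subsets of those indices,
-- each exactly once, as strictly increasing lists.
sublists : {A : Set} → List A → List (List A)
sublists [] = [] ∷ []
sublists (x ∷ xs) = map (x ∷_) (sublists xs) ++ sublists xs

range : ℕ → ℕ → List ℕ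
range lo zero = []
range lo (suc len) = lo ∷ range (suc lo) len

fsum : List ℕ → ℕ
fsum is = sum (map f is)

-- Every index a
-- occurring in a Fibonacci partition of n satisfies a ≤ f a ≤ n, so all
-- admissible index sets are subsets of {k+1, …, k+n} ⊇ {k+1, …, n}.
Fkh : ℕ → ℕ → ℕ → ℕ
Fkh k h n = length (filter (λ s → (length s ≟ h) ×-dec (fsum s ≟ n))
                           (sublists (range (suc k) n)))

F : ℕ → ℕ → ℕ
F h n = Fkh 0 h n

IsZeckendorf : ℕ → List ℕ → Set
IsZeckendorf n μs = All (1 ≤_) μs × Linked (λ a b → a + 2 ≤ b) μs × fsum μs ≡ n

-- Let shift r be the sum of f (i + 1) over the Zeckendorf representation
-- r = Σ f i. Whenever r + 2 ≤ f (a + 1), shift (f a + r) = f (a + 1) + shift r,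
-- and a sum r of distinct f i with 0 < i < a always satisfies this bound. Adding
-- the indices of a set S of positive indices in increasing order therefore
-- gives Σ_{i ∈ S} f (i + 1) = shift (Σ_{i ∈ S} f i). As shift is strictly
-- increasing, shifting all indices by k preserves and reflects equality of
-- sums: an index set above k sums to n iff its unshifted copy sums to
-- Σ f (μᵢ - k), and indices beyond that sum cannot occur in its partitions.
module Submission where

open import Defs
open import Data.Nat using (ℕ; zero; suc; _+_; _∸_; _≤_; _<_; _≤?_; _≟_; z≤n; s≤s; _≤′_; ≤′-refl; ≤′-step)
open import Data.Nat.Properties
open import Data.Nat.GeneralisedArithmetic using (iterate)
open import Data.Nat.ListAction using (sum)
open import Data.List using (List; []; _∷_; _++_; map; length; filter)
open import Data.List.Properties using (map-∘; map-id; map-cong; map-id-local; map-++; length-map; length-++; filter-++; filter-none)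
open import Data.List.Relation.Unary.All as All using (All; []; _∷_)
open import Data.List.Relation.Unary.All.Properties using (++⁺; map⁺)
open import Data.List.Relation.Unary.Linked as Linked using (Linked; [-]; _∷_)
open import Data.List.Relation.Unary.Linked.Properties using (Linked⇒All) renaming (map⁺ to Linked-map⁺)
open import Data.Product using (_×_; _,_)
open import Data.Product.Function.NonDependent.Propositional using (_×-⇔_)
open import Data.Sum using (inj₁; inj₂)
open import Function using (_∘_; _⇔_; mk⇔; Equivalence)
open import Function.Definitions using (Injective)
open import Relation.Binary.Definitions using (tri<; tri≈; tri>)
open import Relation.Nullary using (¬_; yes; no; contradiction)
open import Relation.Nullary.Decidable using (_×-dec_)
open import Relation.Unary using (Decidable; ∁)
open import Relation.Binary.PropositionalEquality
open import Algebra.Properties.CommutativeSemigroup +-commutativeSemigroup using (x∙yz≈yx∙z; xy∙z≈y∙xz)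

f-≤-suc : ∀ j → f j ≤ f (suc j)
f-≤-suc zero = ≤-refl
f-≤-suc (suc j) = m≤m+n (f (suc j)) (f j)

f-mono-≤ : ∀ {i j} → i ≤ j → f i ≤ f j
f-mono-≤ = mono ∘ ≤⇒≤′
  where
  mono : ∀ {i j} → i ≤′ j → f i ≤ f j
  mono ≤′-refl = ≤-refl
  mono (≤′-step {j} i≤′j) = ≤-trans (mono i≤′j) (f-≤-suc j)

f>0 : ∀ j → 0 < f j
f>0 zero = s≤s z≤n
f>0 (suc zero) = s≤s z≤n
f>0 (suc (suc j)) = ≤-trans (f>0 (suc j)) (m≤m+n (f (suc j)) (f j))

n<f[1+n] : ∀ n → n < f (suc n)
n<f[1+n] zero = s≤s z≤n
n<f[1+n] (suc n) = ≤-trans (≤-reflexive (+-comm 1 (suc n))) (+-mono-≤ (n<f[1+n] n) (f>0 n))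

n≤f[n] : ∀ n → n ≤ f n
n≤f[n] zero = z≤n
n≤f[n] (suc n) = n<f[1+n] n

data Split (t : ℕ) : ℕ → Set where
  below : ∀ {n} → n < t → Split t n
  above : ∀ r → Split t (t + r)

split : ∀ t n → Split t n
split t n with t ≤? n
... | yes t≤n = subst (Split t) (m+[n∸m]≡n t≤n) (above (n ∸ t))
... | no t≰n = below (≰⇒> t≰n)

-- greedyShift j r runs the greedy Zeckendorf algorithm on r with the indices
-- j, j - 1, …, 1 and adds up f (i + 1) for every index i that it takes.
greedyShift : ℕ → ℕ → ℕ
greedyShift zero r = 0
greedyShift (suc j) r with f (suc j) ≤? r
... | yes _ = f (suc (suc j)) + greedyShift j (r ∸ f (suc j))
... | no _ = greedyShift j r

-- Index r suffices since r < f (suc r).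
shift : ℕ → ℕ
shift r = greedyShift r r

greedyShift-skip : ∀ j {r} → r < f (suc j) → greedyShift (suc j) r ≡ greedyShift j r
greedyShift-skip j {r} r<f with f (suc j) ≤? r
... | yes f≤r = contradiction f≤r (<⇒≱ r<f)
... | no _ = refl

greedyShift-take : ∀ j r → greedyShift (suc j) (f (suc j) + r) ≡ f (suc (suc j)) + greedyShift j r
greedyShift-take j r with f (suc j) ≤? f (suc j) + r
... | yes _ = cong (λ x → f (suc (suc j)) + greedyShift j x) (m+n∸m≡n (f (suc j)) r)
... | no f≰ = contradiction (m≤m+n (f (suc j)) r) f≰

greedyShift-stable : ∀ {i j r} → i ≤ j → r < f (suc i) → greedyShift j r ≡ greedyShift i r
greedyShift-stable {i} {_} {r} i≤j r<f = stable (≤⇒≤′ i≤j)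
  where
  stable : ∀ {j} → i ≤′ j → greedyShift j r ≡ greedyShift i r
  stable ≤′-refl = refl
  stable (≤′-step {j} i≤′j) =
    trans (greedyShift-skip j (<-≤-trans r<f (f-mono-≤ (s≤s (≤′⇒≤ i≤′j))))) (stable i≤′j)

shift≡greedyShift : ∀ j {r} → r < f (suc j) → shift r ≡ greedyShift j r
shift≡greedyShift j {r} r<f with ≤-total r j
... | inj₁ r≤j = sym (greedyShift-stable r≤j (n<f[1+n] r))
... | inj₂ j≤r = greedyShift-stable j≤r r<f

shift-greedy : ∀ j {r} → r < f j → shift (f (suc j) + r) ≡ f (suc (suc j)) + shift r
shift-greedy j {r} r<f = begin
  shift (f (suc j) + r)                ≡⟨ shift≡greedyShift (suc j) (+-monoʳ-< (f (suc j)) r<f) ⟩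
  greedyShift (suc j) (f (suc j) + r)  ≡⟨ greedyShift-take j r ⟩
  f (suc (suc j)) + greedyShift j r    ≡⟨ cong (f (suc (suc j)) +_) (shift≡greedyShift j (<-≤-trans r<f (f-≤-suc j))) ⟨
  f (suc (suc j)) + shift r            ∎
  where open ≡-Reasoning

-- Either the greedy algorithm takes f (suc a) first, or r ≥ f a and the pair
-- f (suc a) + f a merges into f (suc (suc a)), leaving shift (f a + (r ∸ f a))
-- to recursion.
shift-+ : ∀ a {r} → suc r < f (suc (suc a)) → shift (f (suc a) + r) ≡ f (suc (suc a)) + shift r
shift-+ zero {zero} _ = refl
shift-+ zero {suc r} (s≤s (s≤s ()))
shift-+ (suc a) {r} r<f with split (f (suc a)) r
... | below r<f′ = shift-greedy (suc a) r<f′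
... | above r′ = begin
  shift (f (suc (suc a)) + (f (suc a) + r′))          ≡⟨ cong shift (+-assoc (f (suc (suc a))) (f (suc a)) r′) ⟨
  shift (f (suc (suc (suc a))) + r′)                  ≡⟨ shift-greedy (suc (suc a)) (<⇒≤ r′<f) ⟩
  f (suc (suc (suc (suc a)))) + shift r′              ≡⟨ +-assoc (f (suc (suc (suc a)))) (f (suc (suc a))) (shift r′) ⟩
  f (suc (suc (suc a))) + (f (suc (suc a)) + shift r′) ≡⟨ cong (f (suc (suc (suc a))) +_) (shift-+ a r′<f) ⟨
  f (suc (suc (suc a))) + shift (f (suc a) + r′)      ∎
  where
  open ≡-Reasoning
  r′<f : suc r′ < f (suc (suc a))
  r′<f = +-cancelˡ-< (f (suc a)) (suc r′) (f (suc (suc a)))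
           (subst₂ _<_ (sym (+-suc (f (suc a)) r′)) (+-comm (f (suc (suc a))) (f (suc a))) r<f)

-- The bound on r holds whenever r is a sum of distinct f i with 1 ≤ i ≤ b,
-- as f 1 + ⋯ + f b = f (b + 2) ∸ 2.
shift-sum : ∀ {b} r s → Linked _<_ (b ∷ s) → suc r < f (suc (suc b)) →
            shift (r + fsum s) ≡ shift r + fsum (map suc s)
shift-sum r [] _ _ = trans (cong shift (+-identityʳ r)) (sym (+-identityʳ (shift r)))
shift-sum r (zero ∷ s) (() ∷ _) _
shift-sum r (suc a ∷ s) (b<a ∷ ascending) r<f = begin
  shift (r + (f (suc a) + fsum s))                 ≡⟨ cong shift (x∙yz≈yx∙z r (f (suc a)) (fsum s)) ⟩
  shift ((f (suc a) + r) + fsum s)                 ≡⟨ shift-sum (f (suc a) + r) s ascending r′<f ⟩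
  shift (f (suc a) + r) + fsum (map suc s)         ≡⟨ cong (_+ fsum (map suc s)) (shift-+ a r<f′) ⟩
  (f (suc (suc a)) + shift r) + fsum (map suc s)   ≡⟨ xy∙z≈y∙xz (f (suc (suc a))) (shift r) (fsum (map suc s)) ⟩
  shift r + (f (suc (suc a)) + fsum (map suc s))   ∎
  where
  open ≡-Reasoning
  r<f′ : suc r < f (suc (suc a))
  r<f′ = <-≤-trans r<f (f-mono-≤ (s≤s b<a))
  r′<f : suc (f (suc a) + r) < f (suc (suc (suc a)))
  r′<f = subst₂ _<_ (+-suc (f (suc a)) r) (+-comm (f (suc a)) (f (suc (suc a))))
           (+-monoʳ-< (f (suc a)) r<f′)

Linked-<-lowerHead : ∀ {a b s} → a ≤ b → Linked _<_ (b ∷ s) → Linked _<_ (a ∷ s)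
Linked-<-lowerHead a≤b [-] = [-]
Linked-<-lowerHead a≤b (b<c ∷ ascending) = ≤-<-trans a≤b b<c ∷ ascending

map-suc-ascending : ∀ {s} → Linked _<_ (0 ∷ s) → Linked _<_ (0 ∷ map suc s)
map-suc-ascending ascending =
  Linked-<-lowerHead z≤n (Linked-map⁺ (Linked.map (λ {x} {y} (x<y : x < y) → s≤s x<y) ascending))

fsum-map-suc : ∀ {s} → Linked _<_ (0 ∷ s) → fsum (map suc s) ≡ shift (fsum s)
fsum-map-suc {s} ascending = sym (shift-sum 0 s ascending (s≤s (s≤s z≤n)))

shift-<-f : ∀ Z {m} → m < f Z → shift m < f (suc Z)
shift-<-f zero {zero} _ = s≤s z≤n
shift-<-f zero {suc _} (s≤s ())
shift-<-f (suc Z) {m} m<f with split (f Z) m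
... | below m<f′ = <-≤-trans (shift-<-f Z m<f′) (f-≤-suc (suc Z))
shift-<-f (suc zero) (s≤s ()) | above _
shift-<-f (suc (suc Z)) m<f | above r =
  subst (_< f (suc (suc (suc Z)))) (sym (shift-greedy Z r<f)) (+-monoʳ-< (f (suc (suc Z))) (shift-<-f Z r<f))
  where
  r<f : r < f Z
  r<f = +-cancelˡ-< (f (suc Z)) r (f Z) m<f

shift-mono-<-below : ∀ Z {m n} → m < n → n < f Z → shift m < shift n
shift-mono-<-below zero {n = zero} () _
shift-mono-<-below zero {n = suc _} _ (s≤s ())
shift-mono-<-below (suc Z) {m} {n} m<n n<f with split (f Z) n
... | below n<f′ = shift-mono-<-below Z m<n n<f′
shift-mono-<-below (suc zero) _ (s≤s ()) | above _
shift-mono-<-below (suc (suc Z)) {m} m<n n<f | above r with split (f (suc Z)) m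
... | below m<f′ =
  <-≤-trans (shift-<-f (suc Z) m<f′)
            (≤-trans (m≤m+n (f (suc (suc Z))) (shift r)) (≤-reflexive (sym (shift-greedy Z r<f))))
  where
  r<f : r < f Z
  r<f = +-cancelˡ-< (f (suc Z)) r (f Z) n<f
... | above r′ =
  subst₂ _<_ (sym (shift-greedy Z (<-trans r′<r r<f))) (sym (shift-greedy Z r<f))
    (+-monoʳ-< (f (suc (suc Z))) (shift-mono-<-below Z r′<r r<f))
  where
  r<f : r < f Z
  r<f = +-cancelˡ-< (f (suc Z)) r (f Z) n<f
  r′<r : r′ < r
  r′<r = +-cancelˡ-< (f (suc Z)) r′ r m<n

shift-mono-< : ∀ {m n} → m < n → shift m < shift n
shift-mono-< {n = n} m<n = shift-mono-<-below (suc n) m<n (n<f[1+n] n)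

shift-injective : Injective _≡_ _≡_ shift
shift-injective {m} {n} eq with <-cmp m n
... | tri< m<n _ _ = contradiction eq (<⇒≢ (shift-mono-< m<n))
... | tri≈ _ m≡n _ = m≡n
... | tri> _ _ n<m = contradiction (sym eq) (<⇒≢ (shift-mono-< n<m))

iterate-injective : ∀ {A : Set} {g : A → A} → Injective _≡_ _≡_ g →
                    ∀ k → Injective _≡_ _≡_ (λ x → iterate g x k)
iterate-injective g-inj zero eq = eq
iterate-injective g-inj (suc k) eq = g-inj (iterate-injective g-inj k eq)

fsum-map-+ : ∀ k {s} → Linked _<_ (0 ∷ s) → fsum (map (k +_) s) ≡ iterate shift (fsum s) k
fsum-map-+ zero {s} _ = cong fsum (map-id s)
fsum-map-+ (suc k) {s} ascending = begin
  fsum (map (suc k +_) s)             ≡⟨ cong fsum (trans (map-cong (λ x → sym (+-suc k x)) s) (map-∘ s)) ⟩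
  fsum (map (k +_) (map suc s))       ≡⟨ fsum-map-+ k (map-suc-ascending ascending) ⟩
  iterate shift (fsum (map suc s)) k  ≡⟨ cong (λ x → iterate shift x k) (fsum-map-suc ascending) ⟩
  iterate shift (shift (fsum s)) k    ∎
  where open ≡-Reasoning

fsum-map-+-≡⇔ : ∀ k {s t} → Linked _<_ (0 ∷ s) → Linked _<_ (0 ∷ t) →
                (fsum (map (k +_) s) ≡ fsum (map (k +_) t)) ⇔ (fsum s ≡ fsum t)
fsum-map-+-≡⇔ k {s} {t} ascending-s ascending-t = mk⇔
  (λ eq → iterate-injective shift-injective k
            (trans (sym (fsum-map-+ k ascending-s)) (trans eq (fsum-map-+ k ascending-t))))
  (λ eq → trans (fsum-map-+ k ascending-s)
            (trans (cong (λ x → iterate shift x k) eq) (sym (fsum-map-+ k ascending-t))))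

fsum-≤-fsum-map-+ : ∀ k s → fsum s ≤ fsum (map (k +_) s)
fsum-≤-fsum-map-+ k [] = ≤-refl
fsum-≤-fsum-map-+ k (x ∷ s) = +-mono-≤ (f-mono-≤ (m≤n+m x k)) (fsum-≤-fsum-map-+ k s)

indices-≤-fsum : ∀ s → All (_≤ fsum s) s
indices-≤-fsum [] = []
indices-≤-fsum (x ∷ s) =
  ≤-trans (n≤f[n] x) (m≤m+n (f x) (fsum s))
  ∷ All.map (λ {y} y≤ → ≤-trans y≤ (m≤n+m (fsum s) (f x))) (indices-≤-fsum s)

range-++ : ∀ lo a b → range lo (a + b) ≡ range lo a ++ range (lo + a) b
range-++ lo zero b = cong (λ x → range x b) (sym (+-identityʳ lo))
range-++ lo (suc a) b =
  cong (lo ∷_) (trans (range-++ (suc lo) a b) (cong (λ x → range (suc lo) a ++ range x b) (sym (+-suc lo a))))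

map-+-range : ∀ k lo L → map (k +_) (range lo L) ≡ range (k + lo) L
map-+-range k lo zero = refl
map-+-range k lo (suc L) =
  cong (k + lo ∷_) (trans (map-+-range k (suc lo) L) (cong (λ x → range x L) (+-suc k lo)))

range-≥ : ∀ lo L → All (lo ≤_) (range lo L)
range-≥ lo zero = []
range-≥ lo (suc L) = ≤-refl ∷ All.map (≤-trans (n≤1+n lo)) (range-≥ (suc lo) L)

sublists-map : ∀ {A B : Set} (g : A → B) xs → sublists (map g xs) ≡ map (map g) (sublists xs)
sublists-map g [] = refl
sublists-map g (x ∷ xs) = begin
  map (g x ∷_) (sublists (map g xs)) ++ sublists (map g xs)
    ≡⟨ cong (λ ys → map (g x ∷_) ys ++ ys) (sublists-map g xs) ⟩
  map (g x ∷_) (map (map g) (sublists xs)) ++ map (map g) (sublists xs)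
    ≡⟨ cong (_++ map (map g) (sublists xs)) (trans (sym (map-∘ (sublists xs))) (map-∘ (sublists xs))) ⟩
  map (map g) (map (x ∷_) (sublists xs)) ++ map (map g) (sublists xs)
    ≡⟨ map-++ (map g) (map (x ∷_) (sublists xs)) (sublists xs) ⟨
  map (map g) (map (x ∷_) (sublists xs) ++ sublists xs) ∎
  where open ≡-Reasoning

sublists-range-ascending : ∀ b L → All (λ s → Linked _<_ (b ∷ s)) (sublists (range (suc b) L))
sublists-range-ascending b zero = [-] ∷ []
sublists-range-ascending b (suc L) =
  ++⁺ (map⁺ (All.map (n<1+n b ∷_) ascending)) (All.map (Linked-<-lowerHead (n≤1+n b)) ascending)
  where
  ascending = sublists-range-ascending (suc b) L

count : ∀ {A : Set} {P : A → Set} → Decidable P → List A → ℕ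
count P? = length ∘ filter P?

count-map : ∀ {A B : Set} {P : B → Set} (P? : Decidable P) (g : A → B) xs →
            count P? (map g xs) ≡ count (P? ∘ g) xs
count-map P? g [] = refl
count-map P? g (x ∷ xs) with P? (g x)
... | yes _ = cong suc (count-map P? g xs)
... | no _ = count-map P? g xs

count-cong-local : ∀ {A : Set} {P Q : A → Set} (P? : Decidable P) (Q? : Decidable Q) {xs} →
                   All (λ x → P x ⇔ Q x) xs → count P? xs ≡ count Q? xs
count-cong-local P? Q? [] = refl
count-cong-local P? Q? {x ∷ _} (P⇔Q ∷ rest) with P? x | Q? x
... | yes _ | yes _ = cong suc (count-cong-local P? Q? rest)
... | no _ | no _ = count-cong-local P? Q? rest
... | yes p | no ¬q = contradiction (Equivalence.to P⇔Q p) ¬q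
... | no ¬p | yes q = contradiction (Equivalence.from P⇔Q q) ¬p

count-none : ∀ {A : Set} {P : A → Set} (P? : Decidable P) xs → (∀ x → ¬ P x) → count P? xs ≡ 0
count-none P? xs ¬P = cong length (filter-none P? (All.universal ¬P xs))

count-sublists-∷ : ∀ {A : Set} {P : List A → Set} (P? : Decidable P) x xs →
                   count P? (sublists (x ∷ xs)) ≡ count (P? ∘ (x ∷_)) (sublists xs) + count P? (sublists xs)
count-sublists-∷ P? x xs = begin
  length (filter P? (map (x ∷_) (sublists xs) ++ sublists xs))
    ≡⟨ cong length (filter-++ P? (map (x ∷_) (sublists xs)) (sublists xs)) ⟩
  length (filter P? (map (x ∷_) (sublists xs)) ++ filter P? (sublists xs))
    ≡⟨ length-++ (filter P? (map (x ∷_) (sublists xs))) ⟩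
  count P? (map (x ∷_) (sublists xs)) + count P? (sublists xs)
    ≡⟨ cong (_+ count P? (sublists xs)) (count-map P? (x ∷_) (sublists xs)) ⟩
  count (P? ∘ (x ∷_)) (sublists xs) + count P? (sublists xs) ∎
  where open ≡-Reasoning

count-sublists-++ : ∀ {A : Set} (Q : A → Set) xs ys {P : List A → Set} (P? : Decidable P) →
                    (∀ {s} → P s → All Q s) → All (∁ Q) ys →
                    count P? (sublists (xs ++ ys)) ≡ count P? (sublists xs)
count-sublists-++ Q [] [] P? P⇒Q ¬Q = refl
count-sublists-++ Q [] (y ∷ ys) P? P⇒Q (¬Qy ∷ ¬Q) =
  trans (count-sublists-∷ P? y ys)
        (cong₂ _+_ (count-none (P? ∘ (y ∷_)) (sublists ys) (λ s p → ¬Qy (All.head (P⇒Q p))))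
                   (count-sublists-++ Q [] ys P? P⇒Q ¬Q))
count-sublists-++ Q (x ∷ xs) ys P? P⇒Q ¬Q =
  trans (count-sublists-∷ P? x (xs ++ ys))
        (trans (cong₂ _+_ (count-sublists-++ Q xs ys (P? ∘ (x ∷_)) (All.tail ∘ P⇒Q) ¬Q)
                          (count-sublists-++ Q xs ys P? P⇒Q ¬Q))
               (sym (count-sublists-∷ P? x xs)))

partition? : ∀ h n → Decidable (λ s → length s ≡ h × fsum s ≡ n)
partition? h n s = (length s ≟ h) ×-dec (fsum s ≟ n)

count-partition?-range : ∀ h {m L} → m ≤ L →
                         count (partition? h m) (sublists (range 1 L)) ≡ count (partition? h m) (sublists (range 1 m))
count-partition?-range h {m} m≤L with m≤n⇒∃[o]m+o≡n m≤L
... | d , refl =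
  trans (cong (count (partition? h m) ∘ sublists) (range-++ 1 m d))
        (count-sublists-++ (_≤ m) (range 1 m) (range (suc m) d) (partition? h m)
          (λ { {s} (_ , fsum≡m) → subst (λ n → All (_≤ n) s) fsum≡m (indices-≤-fsum s) })
          (All.map <⇒≱ (range-≥ (suc m) d)))

Fkh-shift : ∀ k h {ν} → Linked _<_ (0 ∷ ν) → Fkh k h (fsum (map (k +_) ν)) ≡ F h (fsum ν)
Fkh-shift k h {ν} ν-ascending = begin
  count (partition? h N) (sublists (range (suc k) N))
    ≡⟨ cong (count (partition? h N) ∘ sublists) range-suc-k ⟩
  count (partition? h N) (sublists (map (k +_) (range 1 N)))
    ≡⟨ cong (count (partition? h N)) (sublists-map (k +_) (range 1 N)) ⟩
  count (partition? h N) (map (map (k +_)) (sublists (range 1 N)))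
    ≡⟨ count-map (partition? h N) (map (k +_)) (sublists (range 1 N)) ⟩
  count (partition? h N ∘ map (k +_)) (sublists (range 1 N))
    ≡⟨ count-cong-local (partition? h N ∘ map (k +_)) (partition? h M)
                        (All.map unshift⇔ (sublists-range-ascending 0 N)) ⟩
  count (partition? h M) (sublists (range 1 N))
    ≡⟨ count-partition?-range h (fsum-≤-fsum-map-+ k ν) ⟩
  F h M ∎
  where
  open ≡-Reasoning
  N = fsum (map (k +_) ν)
  M = fsum ν

  range-suc-k : range (suc k) N ≡ map (k +_) (range 1 N)
  range-suc-k = trans (cong (λ lo → range lo N) (+-comm 1 k)) (sym (map-+-range k 1 N))

  unshift⇔ : ∀ {s} → Linked _<_ (0 ∷ s) →
             (length (map (k +_) s) ≡ h × fsum (map (k +_) s) ≡ N) ⇔ (length s ≡ h × fsum s ≡ M)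
  unshift⇔ {s} s-ascending =
    mk⇔ (trans (sym (length-map (k +_) s))) (trans (length-map (k +_) s))
    ×-⇔ fsum-map-+-≡⇔ k s-ascending ν-ascending

∸-ascending : ∀ {k b xs} → k ≤ b → Linked _<_ (b ∷ xs) → Linked _<_ (b ∸ k ∷ map (_∸ k) xs)
∸-ascending k≤b [-] = [-]
∸-ascending k≤b (b<c ∷ ascending) = ∸-monoˡ-< b<c k≤b ∷ ∸-ascending (≤-trans k≤b (<⇒≤ b<c)) ascending

map-∸-ascending : ∀ {k xs} → Linked _<_ (k ∷ xs) → Linked _<_ (0 ∷ map (_∸ k) xs)
map-∸-ascending {k} {xs} ascending =
  subst (λ b → Linked _<_ (b ∷ map (_∸ k) xs)) (n∸n≡0 k) (∸-ascending ≤-refl ascending)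

map-+-map-∸ : ∀ {k xs} → Linked _<_ (k ∷ xs) → map (k +_) (map (_∸ k) xs) ≡ xs
map-+-map-∸ {xs = []} _ = refl
map-+-map-∸ {k} {x ∷ xs} ascending =
  trans (sym (map-∘ (x ∷ xs)))
        (map-id-local (All.map (m+[n∸m]≡n ∘ <⇒≤)
                               (Linked⇒All <-trans (Linked.head ascending) (Linked.tail ascending))))

lemma1p6 : (n k h : ℕ) → 0 < n → (μ₁ : ℕ) → (μs : List ℕ) →
    IsZeckendorf n (μ₁ ∷ μs) → k < μ₁ →
    Fkh k h n ≡ F h (sum (map (λ m → f (m ∸ k)) (μ₁ ∷ μs)))
lemma1p6 _ k h _ μ₁ μs (_ , gaps , refl) k<μ₁ = begin
  Fkh k h (fsum μ)
    ≡⟨ cong (Fkh k h ∘ fsum) (map-+-map-∸ k-μ-ascending) ⟨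
  Fkh k h (fsum (map (k +_) (map (_∸ k) μ)))
    ≡⟨ Fkh-shift k h (map-∸-ascending k-μ-ascending) ⟩
  F h (fsum (map (_∸ k) μ))
    ≡⟨ cong (F h ∘ sum) (map-∘ {g = f} {f = _∸ k} μ) ⟨
  F h (sum (map (λ m → f (m ∸ k)) μ)) ∎
  where
  open ≡-Reasoning
  μ = μ₁ ∷ μs
  k-μ-ascending : Linked _<_ (k ∷ μ)
  k-μ-ascending = k<μ₁ ∷ Linked.map (λ {a} a+2≤b → <-≤-trans (m<m+n a (s≤s z≤n)) a+2≤b) gaps
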